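{- Let $t\in\mathbb{Q}\cap[0,1]$ and suppose the $q$-Markov number has the form $m^t_q=q^d+\alpha q^{d-1}+\cdots+\alpha q^{1-d}+q^{ -d}$ with $d\ge1$, i.e. $d$ is its degree and $\alpha$ its coefficient of $q^{d-1}$. Then $$t=\frac{d-\alpha}{\alpha+1}.$$
   Context: Let $q$ be a formal variable and $[3]_q=q^2+q+1$. Two rationals $\frac{r}{s}<\frac{r'}{s'}$ in $[0,1]$, written in lowest terms with $s,s'>0$, are Farey neighbours if $r's-rs'=1$; every rational in $(0,1)$ is the mediant $\frac{r+r'}{s+s'}$ of exactly one pair of Farey neighbours in $[0,1]$. The $q$-Markov numbers $m^t_q\in\mathbb{Z}[q^{\pm1}]$, for $t\in(\mathbb{Q}\cap[0,1])\cup\{\frac10\}$, are defined recursively by $m^{0/1}_q=1$, $m^{1/1}_q=q+q^{ -1}$, $m^{1/0}_q=1$, and, for Farey neighbours $\frac rs<\frac{r'}{s'}$ in $[0,1]$, $$m_q^{\frac{r+r'}{s+s'}}=q^{ -1}[3]_q\,m_q^{r/s}\,m_q^{r'/s'}-m_q^{\frac{r'-r}{s'-s}},$$ where $\frac{r'-r}{s'-s}$ is understood as the rational number it represents (it is $\frac10$ for the pair $\frac01,\frac11$). These Laurent polynomials are palindromic, which is why the coefficient of $q^{1-d}$ equals that of $q^{d-1}$. -}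

module Defs where

open import Data.Nat as ℕ using (ℕ; zero; suc; _≡ᵇ_; _<ᵇ_)
open import Data.Integer as ℤ using (ℤ; +_; -[1+_]; ∣_∣)
open import Data.List using (List; []; _∷_; map; replicate; _++_)
open import Data.Bool using (if_then_else_)
open import Data.Rational using (ℚ; ↥_; ↧ₙ_)

-- A value  laurent l [c₀ , c₁ , … , cₖ]  denotes  Σᵢ cᵢ q^(l+i).
-- (Representations are not unique; only the coefficient function
--  `coeff` below is used in the statement.)

record Laurent : Set where
  constructor laurent
  field
    low    : ℤ
    coeffs : List ℤ
open Laurent public

addL : List ℤ → List ℤ → List ℤ
addL []       ys       = ys
addL xs       []       = xs
addL (x ∷ xs) (y ∷ ys) = (x ℤ.+ y) ∷ addL xs ys

mulL : List ℤ → List ℤ → List ℤ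
mulL []       ys = []
mulL (x ∷ xs) ys = addL (map (x ℤ.*_) ys) (+ 0 ∷ mulL xs ys)

-- re-express a Laurent polynomial with lowest exponent l (assumed ≤ low)
shiftTo : ℤ → Laurent → List ℤ
shiftTo l (laurent l₁ cs) = replicate ∣ l₁ ℤ.- l ∣ (+ 0) ++ cs

_+L_ : Laurent → Laurent → Laurent
p +L r = let l = low p ℤ.⊓ low r in laurent l (addL (shiftTo l p) (shiftTo l r))

-L_ : Laurent → Laurent
-L (laurent l cs) = laurent l (map ℤ.-_ cs)

_-L_ : Laurent → Laurent → Laurent
p -L r = p +L (-L r)

_*L_ : Laurent → Laurent → Laurent
laurent l₁ c₁ *L laurent l₂ c₂ = laurent (l₁ ℤ.+ l₂) (mulL c₁ c₂)

infixl 6 _+L_ _-L_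
infixl 7 _*L_

index0 : List ℤ → ℕ → ℤ
index0 []       _       = + 0
index0 (x ∷ xs) zero    = x
index0 (x ∷ xs) (suc n) = index0 xs n

coeff : Laurent → ℤ → ℤ
coeff (laurent l cs) k with k ℤ.- l
... | + n      = index0 cs n
... | -[1+ _ ] = + 0

oneL : Laurent
oneL = laurent (+ 0) (+ 1 ∷ [])

qPlusQinv : Laurent
qPlusQinv = laurent (-[1+ 0 ]) (+ 1 ∷ + 0 ∷ + 1 ∷ [])

qinv3 : Laurent                -- q⁻¹ [3]_q = q⁻¹ + 1 + q
qinv3 = laurent (-[1+ 0 ]) (+ 1 ∷ + 1 ∷ + 1 ∷ [])

-- State: Farey neighbours r/s < r'/s' with values ma = m^{r/s}, mb = m^{r'/s'},
-- and mc = m^{(r'-r)/(s'-s)}.  The mediant value is q⁻¹[3] ma mb - mc.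
-- Going left (pair r/s , mediant): the "difference" fraction is r'/s'.
-- Going right (pair mediant , r'/s'): the "difference" fraction is r/s.

descend : (fuel n d r s r' s' : ℕ) (ma mb mc : Laurent) → Laurent
descend zero    n d r s r' s' ma mb mc = ma   -- unreachable with enough fuel
descend (suc f) n d r s r' s' ma mb mc =
  let mm = qinv3 *L ma *L mb -L mc
      lhs = n ℕ.* (s ℕ.+ s')
      rhs = d ℕ.* (r ℕ.+ r')
  in if lhs ≡ᵇ rhs then mm
     else if lhs <ᵇ rhs
       then descend f n d r s (r ℕ.+ r') (s ℕ.+ s') ma mm mb
       else descend f n d (r ℕ.+ r') (s ℕ.+ s') r' s' mm mb ma

-- m^t_q for t ∈ ℚ ∩ [0,1] (values outside [0,1] are irrelevant).
qMarkov : ℚ → Laurent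
qMarkov t =
  let n = ∣ ↥ t ∣
      d = ↧ₙ t
  in if n ≡ᵇ 0 then oneL
     else if n ≡ᵇ d then qPlusQinv
     else descend d n d 0 1 1 1 oneL qPlusQinv oneL

{-# OPTIONS --safe #-}
-- Induction down the Farey tree: m^{r/s} = q^(r+s-1) + (s-1) q^(r+s-2) + (lower terms).
-- If m = q^D + a q^(D-1) + ⋯ and m′ = q^D′ + a′ q^(D′-1) + ⋯, then q⁻¹[3]_q m m′ begins with
-- q^(D+D′+1) + (a + a′ + 1) q^(D+D′), and the subtracted m^{(r′-r)/(s′-s)} has degree at most
-- D + D′ - 1, so it does not reach these two terms; degrees and subleading coefficients thus add
-- up along mediants exactly as r + s - 1 and s - 1 do. Reading off d = r + s - 1 and α = s - 1
-- from m^t with t = r/s gives (d - α)/(α + 1) = r/s.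
module Submission where

open import Defs
open import Data.Nat as ℕ using (ℕ; zero; suc)
import Data.Nat.Properties as ℕ
open import Data.Integer as ℤ using (ℤ; +_; -[1+_])
import Data.Integer.Properties as ℤ
open import Data.List using (List; []; _∷_)
open import Function using (_∘_)
open import Relation.Binary.PropositionalEquality
open import Relation.Nullary using (contradiction)

module LaurentCoefficients where

  open import Data.Integer using (∣_∣; _+_; _-_; _*_; -_; _<_; _≤_)
  open import Data.Integer.Tactic.RingSolver using (solve-∀)
  open import Data.List using (map; replicate; _++_; length)

  entry : List ℤ → ℤ → ℤ
  entry cs (+ n)    = index0 cs n
  entry cs -[1+ _ ] = + 0

  coeff-laurent : ∀ l cs k → coeff (laurent l cs) k ≡ entry cs (k - l)
  coeff-laurent l cs k with k - l
  ... | + _      = refl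
  ... | -[1+ _ ] = refl

  entry-[] : ∀ i → entry [] i ≡ + 0
  entry-[] (+ _)    = refl
  entry-[] -[1+ _ ] = refl

  entry-<0 : ∀ cs {i} → i < + 0 → entry cs i ≡ + 0
  entry-<0 cs { -[1+ _ ]} _           = refl
  entry-<0 cs {+ _}       (ℤ.+<+ ())

  entry-≥length : ∀ cs {i} → + length cs ≤ i → entry cs i ≡ + 0
  entry-≥length cs (ℤ.+≤+ len≤n) = go cs len≤n
    where
    go : ∀ cs {n} → length cs ℕ.≤ n → index0 cs n ≡ + 0
    go []       _             = refl
    go (_ ∷ cs) (ℕ.s≤s len≤n) = go cs len≤n

  entry-∷ : ∀ x xs {i} → i ≢ + 0 → entry (x ∷ xs) i ≡ entry xs (i - + 1)
  entry-∷ x xs {+ zero}    i≢0 = contradiction refl i≢0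
  entry-∷ x xs {+ suc n}   _   = refl
  entry-∷ x xs { -[1+ n ]} _   = refl

  entry-0∷ : ∀ xs i → entry (+ 0 ∷ xs) i ≡ entry xs (i - + 1)
  entry-0∷ xs (+ zero)    = refl
  entry-0∷ xs (+ suc n)   = refl
  entry-0∷ xs -[1+ n ]    = refl

  entry-addL : ∀ xs ys i → entry (addL xs ys) i ≡ entry xs i + entry ys i
  entry-addL xs ys -[1+ _ ] = refl
  entry-addL xs ys (+ n)    = go xs ys n
    where
    go : ∀ xs ys n → index0 (addL xs ys) n ≡ index0 xs n + index0 ys n
    go []       ys       n       = sym (ℤ.+-identityˡ _)
    go (x ∷ xs) []       n       = sym (ℤ.+-identityʳ _)
    go (x ∷ xs) (y ∷ ys) zero    = refl
    go (x ∷ xs) (y ∷ ys) (suc n) = go xs ys n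

  entry-map : ∀ (f : ℤ → ℤ) → f (+ 0) ≡ + 0 → ∀ ys i → entry (map f ys) i ≡ f (entry ys i)
  entry-map f f0≡0 ys -[1+ _ ] = sym f0≡0
  entry-map f f0≡0 ys (+ n)    = go ys n
    where
    go : ∀ ys n → index0 (map f ys) n ≡ f (index0 ys n)
    go []       n       = sym f0≡0
    go (y ∷ ys) zero    = refl
    go (y ∷ ys) (suc n) = go ys n

  entry-replicate : ∀ m cs i → entry (replicate m (+ 0) ++ cs) i ≡ entry cs (i - + m)
  entry-replicate zero    cs i = cong (entry cs) (sym (ℤ.+-identityʳ i))
  entry-replicate (suc m) cs i = begin
    entry (+ 0 ∷ replicate m (+ 0) ++ cs) i  ≡⟨ entry-0∷ _ i ⟩
    entry (replicate m (+ 0) ++ cs) (i - + 1) ≡⟨ entry-replicate m cs (i - + 1) ⟩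
    entry cs (i - + 1 - + m)                  ≡⟨ cong (entry cs) (shift i (+ m)) ⟩
    entry cs (i - + suc m)                    ∎
    where
    open ≡-Reasoning
    shift : ∀ i m → i - + 1 - m ≡ i - (+ 1 + m)
    shift = solve-∀

  coeff-[] : ∀ l k → coeff (laurent l []) k ≡ + 0
  coeff-[] l k = trans (coeff-laurent l [] k) (entry-[] (k - l))

  coeff-below : ∀ l cs {k} → k < l → coeff (laurent l cs) k ≡ + 0
  coeff-below l cs {k} k<l =
    trans (coeff-laurent l cs k) (entry-<0 cs (subst (k - l <_) (ℤ.+-inverseʳ l) (ℤ.+-monoˡ-< (- l) k<l)))

  coeff-∷-here : ∀ l x xs → coeff (laurent l (x ∷ xs)) l ≡ x
  coeff-∷-here l x xs = trans (coeff-laurent l (x ∷ xs) l) (cong (entry (x ∷ xs)) (ℤ.+-inverseʳ l))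

  coeff-∷-there : ∀ l x xs {k} → k ≢ l → coeff (laurent l (x ∷ xs)) k ≡ coeff (laurent (l + + 1) xs) k
  coeff-∷-there l x xs {k} k≢l = begin
    coeff (laurent l (x ∷ xs)) k        ≡⟨ coeff-laurent l (x ∷ xs) k ⟩
    entry (x ∷ xs) (k - l)              ≡⟨ entry-∷ x xs (k≢l ∘ ℤ.i-j≡0⇒i≡j k l) ⟩
    entry xs (k - l - + 1)              ≡⟨ cong (entry xs) (shift k l) ⟩
    entry xs (k - (l + + 1))            ≡⟨ coeff-laurent (l + + 1) xs k ⟨
    coeff (laurent (l + + 1) xs) k      ∎
    where
    open ≡-Reasoning
    shift : ∀ k l → k - l - + 1 ≡ k - (l + + 1)
    shift = solve-∀

  coeff-shiftTo : ∀ l p k → l ≤ low p → entry (shiftTo l p) (k - l) ≡ coeff p k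
  coeff-shiftTo l (laurent l₁ cs) k l≤l₁ = begin
    entry (replicate ∣ l₁ - l ∣ (+ 0) ++ cs) (k - l)
      ≡⟨ entry-replicate ∣ l₁ - l ∣ cs (k - l) ⟩
    entry cs (k - l - + ∣ l₁ - l ∣)
      ≡⟨ cong (λ g → entry cs (k - l - g)) (ℤ.0≤i⇒+∣i∣≡i (ℤ.i≤j⇒0≤j-i l≤l₁)) ⟩
    entry cs (k - l - (l₁ - l))
      ≡⟨ cong (entry cs) (cancel k l l₁) ⟩
    entry cs (k - l₁)
      ≡⟨ coeff-laurent l₁ cs k ⟨
    coeff (laurent l₁ cs) k ∎
    where
    open ≡-Reasoning
    cancel : ∀ k l l₁ → k - l - (l₁ - l) ≡ k - l₁
    cancel = solve-∀

  coeff-+L : ∀ p r k → coeff (p +L r) k ≡ coeff p k + coeff r k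
  coeff-+L p r k = begin
    coeff (p +L r) k                                    ≡⟨ coeff-laurent l _ k ⟩
    entry (addL (shiftTo l p) (shiftTo l r)) (k - l)     ≡⟨ entry-addL (shiftTo l p) (shiftTo l r) (k - l) ⟩
    entry (shiftTo l p) (k - l) + entry (shiftTo l r) (k - l)
      ≡⟨ cong₂ _+_ (coeff-shiftTo l p k (ℤ.i⊓j≤i _ _)) (coeff-shiftTo l r k (ℤ.i⊓j≤j _ _)) ⟩
    coeff p k + coeff r k                                ∎
    where
    open ≡-Reasoning
    l : ℤ
    l = low p ℤ.⊓ low r

  coeff-negL : ∀ p k → coeff (-L p) k ≡ - coeff p k
  coeff-negL (laurent l cs) k = begin
    coeff (laurent l (map -_ cs)) k  ≡⟨ coeff-laurent l (map -_ cs) k ⟩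
    entry (map -_ cs) (k - l)        ≡⟨ entry-map -_ refl cs (k - l) ⟩
    - entry cs (k - l)               ≡⟨ cong -_ (coeff-laurent l cs k) ⟨
    - coeff (laurent l cs) k         ∎
    where open ≡-Reasoning

  coeff-subL : ∀ p r k → coeff (p -L r) k ≡ coeff p k - coeff r k
  coeff-subL p r k = trans (coeff-+L p (-L r) k) (cong (λ c → coeff p k + c) (coeff-negL r k))

  coeff-*L-∷ : ∀ l x xs r k →
    coeff (laurent l (x ∷ xs) *L r) k ≡ x * coeff r (k - l) + coeff (laurent (l + + 1) xs *L r) k
  coeff-*L-∷ l x xs (laurent l₂ ys) k = begin
    coeff (laurent (l + l₂) (addL (map (x *_) ys) (+ 0 ∷ mulL xs ys))) k
      ≡⟨ coeff-laurent (l + l₂) _ k ⟩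
    entry (addL (map (x *_) ys) (+ 0 ∷ mulL xs ys)) (k - (l + l₂))
      ≡⟨ entry-addL (map (x *_) ys) (+ 0 ∷ mulL xs ys) (k - (l + l₂)) ⟩
    entry (map (x *_) ys) (k - (l + l₂)) + entry (+ 0 ∷ mulL xs ys) (k - (l + l₂))
      ≡⟨ cong₂ _+_ (entry-map (x *_) (ℤ.*-zeroʳ x) ys (k - (l + l₂))) (entry-0∷ (mulL xs ys) (k - (l + l₂))) ⟩
    x * entry ys (k - (l + l₂)) + entry (mulL xs ys) (k - (l + l₂) - + 1)
      ≡⟨ cong₂ (λ i j → x * entry ys i + entry (mulL xs ys) j) (regroup k l l₂) (shift k l l₂) ⟩
    x * entry ys (k - l - l₂) + entry (mulL xs ys) (k - (l + + 1 + l₂))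
      ≡⟨ cong₂ (λ a b → x * a + b) (coeff-laurent l₂ ys (k - l)) (coeff-laurent (l + + 1 + l₂) (mulL xs ys) k) ⟨
    x * coeff (laurent l₂ ys) (k - l) + coeff (laurent (l + + 1 + l₂) (mulL xs ys)) k
      ∎
    where
    open ≡-Reasoning
    regroup : ∀ k l l₂ → k - (l + l₂) ≡ k - l - l₂
    regroup = solve-∀
    shift : ∀ k l l₂ → k - (l + l₂) - + 1 ≡ k - (l + + 1 + l₂)
    shift = solve-∀

open LaurentCoefficients

module LeadingTerms where

  open import Data.Integer using (_+_; _-_; _*_; -_; _<_; _≤_)
  open import Data.Integer.Tactic.RingSolver using (solve-∀)
  open import Data.List using (length)
  open import Relation.Binary.Definitions using (tri<; tri≈; tri>)
  open import Relation.Nullary using (yes; no)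

  i-1<i : ∀ i → i - + 1 < i
  i-1<i i = subst (i - + 1 <_) (ℤ.+-identityʳ i) (ℤ.+-monoʳ-< i (ℤ.-<+ {0} {0}))

  i<i+1 : ∀ i → i < i + + 1
  i<i+1 i = subst (_< i + + 1) (ℤ.+-identityʳ i) (ℤ.+-monoʳ-< i (ℤ.+<+ (ℕ.s≤s ℕ.z≤n)))

  i<j⇒i≤j-1 : ∀ {i j} → i < j → i ≤ j - + 1
  i<j⇒i≤j-1 {i} {j} i<j = subst (i ≤_) (ℤ.+-comm (ℤ.-[1+ 0 ]) j) (ℤ.i<j⇒i≤pred[j] i<j)

  i-1+j<i+j : ∀ i j → i - + 1 + j < i + j
  i-1+j<i+j i j = ℤ.+-monoˡ-< j (i-1<i i)

  i+j<k⇒j<k-i : ∀ {i j k} → i + j < k → j < k - i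
  i+j<k⇒j<k-i {i} {j} {k} i+j<k = subst (_< k - i) (cancel i j) (ℤ.+-monoˡ-< (- i) i+j<k)
    where
    cancel : ∀ i j → i + j - i ≡ j
    cancel = solve-∀

  VanishesAbove : Laurent → ℤ → Set
  VanishesAbove p D = ∀ k → D < k → coeff p k ≡ + 0

  VanishesAbove-mono : ∀ {p D D′} → D ≤ D′ → VanishesAbove p D → VanishesAbove p D′
  VanishesAbove-mono D≤D′ p≡0 k D′<k = p≡0 k (ℤ.≤-<-trans D≤D′ D′<k)

  laurent-vanishesAbove : ∀ l cs → VanishesAbove (laurent l cs) (l + + length cs - + 1)
  laurent-vanishesAbove l cs k top<k = trans (coeff-laurent l cs k) (entry-≥length cs length≤k-l)
    where
    open ℤ.≤-Reasoning
    length≤k-l : + length cs ≤ k - l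
    length≤k-l = begin
      + length cs                           ≡⟨ cancel l (+ length cs) ⟩
      ℤ.suc (l + + length cs - + 1) - l     ≤⟨ ℤ.+-monoˡ-≤ (- l) (ℤ.i<j⇒suc[i]≤j top<k) ⟩
      k - l                                 ∎
      where
      cancel : ∀ l n → n ≡ + 1 + (l + n - + 1) - l
      cancel = solve-∀

  record Monic (p : Laurent) (D a : ℤ) : Set where
    field
      vanishesAbove : VanishesAbove p D
      leading       : coeff p D ≡ + 1
      subleading    : coeff p (D - + 1) ≡ a
  open Monic

  module Tail (l x : ℤ) (xs : List ℤ) where
    p p′ : Laurent
    p  = laurent l (x ∷ xs)
    p′ = laurent (l + + 1) xs

    agree : ∀ {j} → j ≢ l → coeff p′ j ≡ coeff p j
    agree j≢l = sym (coeff-∷-there l x xs j≢l)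

    p′-at-l : coeff p′ l ≡ + 0
    p′-at-l = coeff-below (l + + 1) xs (i<i+1 l)

    p′-vanishesAbove : ∀ {D} → VanishesAbove p D → VanishesAbove p′ D
    p′-vanishesAbove p≡0 k D<k with k ℤ.≟ l
    ... | yes refl = p′-at-l
    ... | no k≢l   = trans (agree k≢l) (p≡0 k D<k)

  topTerms : Laurent → ℤ → (ℤ → ℤ) → ℤ
  topTerms p D f = coeff p D * f D + coeff p (D - + 1) * f (D - + 1)

  -- The lowest term x q^l matters only for l ∈ {D - 1, D}: if l > D then x = 0, if l < D - 1 then f l = 0.
  topTerms-∷ : ∀ l x xs {D} (f : ℤ → ℤ) →
    VanishesAbove (laurent l (x ∷ xs)) D → (∀ j → j < D - + 1 → f j ≡ + 0) →
    x * f l + topTerms (laurent (l + + 1) xs) D f ≡ topTerms (laurent l (x ∷ xs)) D f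
  topTerms-∷ l x xs {D} f p≡0 f≡0 with ℤ.<-cmp l D
  ... | tri> _ _ D<l = begin
    x * f l + (coeff p′ D * f D + coeff p′ (D - + 1) * f (D - + 1))
      ≡⟨ cong₂ (λ y z → y * f l + z) x≡0 (cong₂ (λ a b → a * f D + b * f (D - + 1))
                                                (agree (ℤ.<⇒≢ D<l)) (agree (ℤ.<⇒≢ (ℤ.<-trans (i-1<i D) D<l)))) ⟩
    + 0 * f l + topTerms p D f   ≡⟨ ℤ.+-identityˡ _ ⟩
    topTerms p D f               ∎
    where
    open ≡-Reasoning
    open Tail l x xs
    x≡0 : x ≡ + 0
    x≡0 = trans (sym (coeff-∷-here l x xs)) (p≡0 l D<l)
  ... | tri≈ _ refl _ = begin
    x * f D + (coeff p′ D * f D + coeff p′ (D - + 1) * f (D - + 1))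
      ≡⟨ cong₂ (λ a b → x * f D + (a * f D + b * f (D - + 1))) p′-at-l (agree (ℤ.<⇒≢ (i-1<i D))) ⟩
    x * f D + (+ 0 * f D + coeff p (D - + 1) * f (D - + 1))
      ≡⟨ cong₂ (λ a b → a * f D + b) (sym (coeff-∷-here l x xs)) (ℤ.+-identityˡ _) ⟩
    topTerms p D f ∎
    where
    open ≡-Reasoning
    open Tail l x xs
  ... | tri< l<D _ _ with l ℤ.≟ D - + 1
  ...   | yes refl = begin
    x * f l + (coeff p′ D * f D + coeff p′ l * f l)
      ≡⟨ cong₂ (λ a b → x * f l + (a * f D + b * f l)) (agree (ℤ.<⇒≢ l<D ∘ sym)) p′-at-l ⟩
    x * f l + (coeff p D * f D + + 0 * f l)
      ≡⟨ swap x (f l) (coeff p D) (f D) ⟩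
    coeff p D * f D + x * f l
      ≡⟨ cong (λ a → coeff p D * f D + a * f l) (sym (coeff-∷-here l x xs)) ⟩
    topTerms p D f ∎
    where
    open ≡-Reasoning
    open Tail l x xs
    swap : ∀ a b c d → a * b + (c * d + + 0 * b) ≡ c * d + a * b
    swap = solve-∀
  ...   | no l≢D-1 = begin
    x * f l + (coeff p′ D * f D + coeff p′ (D - + 1) * f (D - + 1))
      ≡⟨ cong₂ (λ y z → x * y + z) (f≡0 l l<D-1) (cong₂ (λ a b → a * f D + b * f (D - + 1))
                                                        (agree (ℤ.<⇒≢ l<D ∘ sym)) (agree (ℤ.<⇒≢ l<D-1 ∘ sym))) ⟩
    x * + 0 + topTerms p D f   ≡⟨ cong (_+ topTerms p D f) (ℤ.*-zeroʳ x) ⟩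
    + 0 + topTerms p D f       ≡⟨ ℤ.+-identityˡ _ ⟩
    topTerms p D f             ∎
    where
    open ≡-Reasoning
    open Tail l x xs
    l<D-1 : l < D - + 1
    l<D-1 = ℤ.≤∧≢⇒< (i<j⇒i≤j-1 l<D) l≢D-1

  coeff-*L-top : ∀ l cs r {D E} → VanishesAbove (laurent l cs) D → VanishesAbove r E →
    ∀ k → D - + 1 + E ≤ k → coeff (laurent l cs *L r) k ≡ topTerms (laurent l cs) D (λ j → coeff r (k - j))
  coeff-*L-top l [] r {D} _ _ k _ =
    trans (coeff-[] _ k) (sym (cong₂ (λ a b → a * coeff r (k - D) + b * coeff r (k - (D - + 1)))
                                     (coeff-[] l D) (coeff-[] l (D - + 1))))
  coeff-*L-top l (x ∷ xs) r {D} {E} p≡0 r≡0 k D-1+E≤k = begin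
    coeff (p *L r) k              ≡⟨ coeff-*L-∷ l x xs r k ⟩
    x * g l + coeff (p′ *L r) k
      ≡⟨ cong (_+_ (x * g l)) (coeff-*L-top (l + + 1) xs r (p′-vanishesAbove p≡0) r≡0 k D-1+E≤k) ⟩
    x * g l + topTerms p′ D g     ≡⟨ topTerms-∷ l x xs g p≡0 g≡0 ⟩
    topTerms p D g                ∎
    where
    open ≡-Reasoning
    open Tail l x xs
    g : ℤ → ℤ
    g j = coeff r (k - j)
    g≡0 : ∀ j → j < D - + 1 → g j ≡ + 0
    g≡0 j j<D-1 = r≡0 (k - j) (i+j<k⇒j<k-i (ℤ.<-≤-trans (ℤ.+-monoˡ-< E j<D-1) D-1+E≤k))

  *L-vanishesAbove : ∀ {p r D E} → VanishesAbove p D → VanishesAbove r E → VanishesAbove (p *L r) (D + E)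
  *L-vanishesAbove {p} {r} {D} {E} p≡0 r≡0 k D+E<k = begin
    coeff (p *L r) k
      ≡⟨ coeff-*L-top (low p) (coeffs p) r p≡0 r≡0 k (ℤ.<⇒≤ D-1+E<k) ⟩
    coeff p D * coeff r (k - D) + coeff p (D - + 1) * coeff r (k - (D - + 1))
      ≡⟨ cong₂ (λ u v → coeff p D * u + coeff p (D - + 1) * v)
               (r≡0 (k - D) (i+j<k⇒j<k-i D+E<k)) (r≡0 (k - (D - + 1)) (i+j<k⇒j<k-i D-1+E<k)) ⟩
    coeff p D * + 0 + coeff p (D - + 1) * + 0
      ≡⟨ cong₂ _+_ (ℤ.*-zeroʳ (coeff p D)) (ℤ.*-zeroʳ (coeff p (D - + 1))) ⟩
    + 0 ∎
    where
    open ≡-Reasoning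
    D-1+E<k : D - + 1 + E < k
    D-1+E<k = ℤ.<-trans (i-1+j<i+j D E) D+E<k

  *L-monic : ∀ {p r D E a b} → Monic p D a → Monic r E b → Monic (p *L r) (D + E) (a + b)
  *L-monic {p} {r} {D} {E} {a} {b} mp mr = record
    { vanishesAbove = *L-vanishesAbove (vanishesAbove mp) (vanishesAbove mr)
    ; leading = begin
        coeff (p *L r) (D + E)
          ≡⟨ top (D + E) (ℤ.<⇒≤ (i-1+j<i+j D E)) ⟩
        coeff p D * coeff r (D + E - D) + coeff p (D - + 1) * coeff r (D + E - (D - + 1))
          ≡⟨ cong₂ (λ u v → coeff p D * coeff r u + coeff p (D - + 1) * v)
                   (cancel₁ D E) (vanishesAbove mr (D + E - (D - + 1)) (i+j<k⇒j<k-i (i-1+j<i+j D E))) ⟩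
        coeff p D * coeff r E + coeff p (D - + 1) * + 0
          ≡⟨ cong₂ _+_ (cong₂ _*_ (leading mp) (leading mr)) (ℤ.*-zeroʳ (coeff p (D - + 1))) ⟩
        + 1 ∎
    ; subleading = begin
        coeff (p *L r) (D + E - + 1)
          ≡⟨ top (D + E - + 1) (ℤ.≤-reflexive (cancel₂ D E)) ⟩
        coeff p D * coeff r (D + E - + 1 - D) + coeff p (D - + 1) * coeff r (D + E - + 1 - (D - + 1))
          ≡⟨ cong₂ (λ u v → coeff p D * coeff r u + coeff p (D - + 1) * coeff r v) (cancel₃ D E) (cancel₄ D E) ⟩
        coeff p D * coeff r (E - + 1) + coeff p (D - + 1) * coeff r E
          ≡⟨ cong₂ _+_ (cong₂ _*_ (leading mp) (subleading mr)) (cong₂ _*_ (subleading mp) (leading mr)) ⟩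
        + 1 * b + a * + 1
          ≡⟨ collect a b ⟩
        a + b ∎
    }
    where
    open ≡-Reasoning
    top : ∀ k → D - + 1 + E ≤ k → coeff (p *L r) k ≡ topTerms p D (λ j → coeff r (k - j))
    top = coeff-*L-top (low p) (coeffs p) r (vanishesAbove mp) (vanishesAbove mr)
    cancel₁ : ∀ D E → D + E - D ≡ E
    cancel₁ = solve-∀
    cancel₂ : ∀ D E → D - + 1 + E ≡ D + E - + 1
    cancel₂ = solve-∀
    cancel₃ : ∀ D E → D + E - + 1 - D ≡ E - + 1
    cancel₃ = solve-∀
    cancel₄ : ∀ D E → D + E - + 1 - (D - + 1) ≡ E
    cancel₄ = solve-∀
    collect : ∀ a b → + 1 * b + a * + 1 ≡ a + b
    collect = solve-∀

  -L-monic : ∀ {p r D a} → Monic p D a → VanishesAbove r (D - + 1 - + 1) → Monic (p -L r) D a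
  -L-monic {p} {r} {D} {a} mp r≡0 = record
    { vanishesAbove = λ k D<k → begin
        coeff (p -L r) k          ≡⟨ coeff-subL p r k ⟩
        coeff p k - coeff r k     ≡⟨ cong₂ _-_ (vanishesAbove mp k D<k) (r≡0 k (ℤ.<-trans D-2<D D<k)) ⟩
        + 0                       ∎
    ; leading = begin
        coeff (p -L r) D          ≡⟨ coeff-subL p r D ⟩
        coeff p D - coeff r D     ≡⟨ cong₂ _-_ (leading mp) (r≡0 D D-2<D) ⟩
        + 1                       ∎
    ; subleading = begin
        coeff (p -L r) (D - + 1)              ≡⟨ coeff-subL p r (D - + 1) ⟩
        coeff p (D - + 1) - coeff r (D - + 1) ≡⟨ cong₂ _-_ (subleading mp) (r≡0 (D - + 1) (i-1<i (D - + 1))) ⟩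
        a - + 0                               ≡⟨ ℤ.+-identityʳ a ⟩
        a                                     ∎
    }
    where
    open ≡-Reasoning
    D-2<D : D - + 1 - + 1 < D
    D-2<D = ℤ.<-trans (i-1<i (D - + 1)) (i-1<i D)

  laurent-monic : ∀ l cs {D a} → l + + length cs - + 1 ≡ D →
    coeff (laurent l cs) D ≡ + 1 → coeff (laurent l cs) (D - + 1) ≡ a → Monic (laurent l cs) D a
  laurent-monic l cs refl leading subleading = record
    { vanishesAbove = laurent-vanishesAbove l cs ; leading = leading ; subleading = subleading }

  qinv3-monic : Monic qinv3 (+ 1) (+ 1)
  qinv3-monic = laurent-monic _ _ refl refl refl

  mediant-monic : ∀ {m m′ m″ D D′ a a′} → Monic m D a → Monic m′ D′ a′ → VanishesAbove m″ (D + D′ - + 1) →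
    Monic (qinv3 *L m *L m′ -L m″) (+ 1 + D + D′) (+ 1 + a + a′)
  mediant-monic {D = D} {D′} mm mm′ m″≡0 =
    -L-monic (*L-monic (*L-monic qinv3-monic mm) mm′) (subst (VanishesAbove _) (shift D D′) m″≡0)
    where
    shift : ∀ D D′ → D + D′ - + 1 ≡ + 1 + D + D′ - + 1 - + 1
    shift = solve-∀

  monic-degree-unique : ∀ {p D D′ a} → Monic p D a → coeff p D′ ≡ + 1 → VanishesAbove p D′ → D′ ≡ D
  monic-degree-unique {D = D} {D′} mp leading′ p≡0 with ℤ.<-cmp D′ D
  ... | tri< D′<D _ _ = contradiction (trans (sym (leading mp)) (p≡0 D D′<D)) λ ()
  ... | tri≈ _ D′≡D _ = D′≡D
  ... | tri> _ _ D<D′ = contradiction (trans (sym leading′) (vanishesAbove mp D′ D<D′)) λ ()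

open LeadingTerms

module FareyDescent where

  open import Data.Nat using (_+_; _*_; _≤_; _<_)
  open import Data.Nat.Tactic.RingSolver using (solve-∀)
  import Data.Integer.Tactic.RingSolver as ℤ-Solver
  open import Data.Rational as ℚ using (mkℚ; 0ℚ; 1ℚ; *≤*; ↥_; ↧_)
  open import Data.Bool using (true; false)
  open import Data.Empty using (⊥-elim)
  open import Data.Product using (Σ-syntax; _×_; _,_)
  open import Relation.Nullary.Reflects using (Reflects; ofʸ; ofⁿ; fromEquivalence)

  markovDegree : ℕ → ℕ → ℤ
  markovDegree r s = + r ℤ.+ + s ℤ.- + 1

  MarkovLeading : Laurent → ℕ → ℕ → Set
  MarkovLeading m r s = Monic m (markovDegree r s) (+ s ℤ.- + 1)

  mediant-markovLeading : ∀ r s r′ s′ {m m′ m″} → MarkovLeading m r s → MarkovLeading m′ r′ s′ →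
    VanishesAbove m″ (markovDegree r s ℤ.+ markovDegree r′ s′ ℤ.- + 1) →
    MarkovLeading (qinv3 *L m *L m′ -L m″) (r + r′) (s + s′)
  mediant-markovLeading r s r′ s′ ml ml′ m″≡0 =
    subst₂ (Monic _) (degree (+ r) (+ s) (+ r′) (+ s′)) (subdegree (+ s) (+ s′)) (mediant-monic ml ml′ m″≡0)
    where
    degree : ∀ r s r′ s′ → + 1 ℤ.+ (r ℤ.+ s ℤ.- + 1) ℤ.+ (r′ ℤ.+ s′ ℤ.- + 1) ≡ r ℤ.+ r′ ℤ.+ (s ℤ.+ s′) ℤ.- + 1
    degree = ℤ-Solver.solve-∀
    subdegree : ∀ s s′ → + 1 ℤ.+ (s ℤ.- + 1) ℤ.+ (s′ ℤ.- + 1) ≡ s ℤ.+ s′ ℤ.- + 1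
    subdegree = ℤ-Solver.solve-∀

  record Neighbours (r s r′ s′ : ℕ) : Set where
    field
      unimodular : r′ * s ≡ suc (r * s′)
      s≥1        : 1 ≤ s
      s′≥1       : 1 ≤ s′
  open Neighbours

  neighbours-left : ∀ {r s r′ s′} → Neighbours r s r′ s′ → Neighbours r s (r + r′) (s + s′)
  neighbours-left {r} {s} {r′} {s′} nb = record
    { unimodular = begin
        (r + r′) * s          ≡⟨ distrib r r′ s ⟩
        r * s + r′ * s        ≡⟨ cong (_+_ (r * s)) (unimodular nb) ⟩
        r * s + suc (r * s′)  ≡⟨ collect r s s′ ⟩
        suc (r * (s + s′))    ∎
    ; s≥1  = s≥1 nb
    ; s′≥1 = ℕ.≤-trans (s≥1 nb) (ℕ.m≤m+n s s′)
    }
    where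
    open ≡-Reasoning
    distrib : ∀ r r′ s → (r + r′) * s ≡ r * s + r′ * s
    distrib = solve-∀
    collect : ∀ r s s′ → r * s + suc (r * s′) ≡ suc (r * (s + s′))
    collect = solve-∀

  neighbours-right : ∀ {r s r′ s′} → Neighbours r s r′ s′ → Neighbours (r + r′) (s + s′) r′ s′
  neighbours-right {r} {s} {r′} {s′} nb = record
    { unimodular = begin
        r′ * (s + s′)              ≡⟨ distrib r′ s s′ ⟩
        r′ * s + r′ * s′           ≡⟨ cong (_+ r′ * s′) (unimodular nb) ⟩
        suc (r * s′) + r′ * s′     ≡⟨ collect r r′ s′ ⟩
        suc ((r + r′) * s′)        ∎
    ; s≥1  = ℕ.≤-trans (s≥1 nb) (ℕ.m≤m+n s s′)
    ; s′≥1 = s′≥1 nb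
    }
    where
    open ≡-Reasoning
    distrib : ∀ r′ s s′ → r′ * (s + s′) ≡ r′ * s + r′ * s′
    distrib = solve-∀
    collect : ∀ r r′ s′ → suc (r * s′) + r′ * s′ ≡ suc ((r + r′) * s′)
    collect = solve-∀

  between-neighbours⇒≤ : ∀ {n d r s r′ s′} → Neighbours r s r′ s′ →
    d * r < n * s → n * s′ < d * r′ → s + s′ ≤ d
  between-neighbours⇒≤ {n} {d} {r} {s} {r′} {s′} nb below above = ℕ.+-cancelˡ-≤ (d * r * s′) (s + s′) d (begin
    d * r * s′ + (s + s′)       ≡⟨ regroup₁ d r s s′ ⟩
    suc (d * r) * s′ + s        ≤⟨ ℕ.+-monoˡ-≤ s (ℕ.*-monoˡ-≤ s′ below) ⟩
    n * s * s′ + s              ≡⟨ regroup₂ n s s′ ⟩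
    suc (n * s′) * s            ≤⟨ ℕ.*-monoˡ-≤ s above ⟩
    d * r′ * s                  ≡⟨ ℕ.*-assoc d r′ s ⟩
    d * (r′ * s)                ≡⟨ cong (d *_) (unimodular nb) ⟩
    d * suc (r * s′)            ≡⟨ regroup₃ d r s′ ⟩
    d * r * s′ + d              ∎)
    where
    open ℕ.≤-Reasoning
    regroup₁ : ∀ d r s s′ → d * r * s′ + (s + s′) ≡ suc (d * r) * s′ + s
    regroup₁ = solve-∀
    regroup₂ : ∀ n s s′ → n * s * s′ + s ≡ suc (n * s′) * s
    regroup₂ = solve-∀
    regroup₃ : ∀ d r s′ → d * suc (r * s′) ≡ d * r * s′ + d
    regroup₃ = solve-∀

  ≤-by-gap : ∀ {i j} n → i ℤ.+ + n ≡ j → i ℤ.≤ j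
  ≤-by-gap {i} n i+n≡j = subst (i ℤ.≤_) i+n≡j (ℤ.i≤i+j i (+ n))

  markovDegree-left : ∀ r s r′ s′ → 1 ≤ s →
    markovDegree r′ s′ ℤ.≤ markovDegree r s ℤ.+ markovDegree (r + r′) (s + s′) ℤ.- + 1
  markovDegree-left r (suc s₀) r′ s′ _ = ≤-by-gap (r + r + s₀ + s₀) (gap (+ r) (+ s₀) (+ r′) (+ s′))
    where
    gap : ∀ r s₀ r′ s′ → r′ ℤ.+ s′ ℤ.- + 1 ℤ.+ (r ℤ.+ r ℤ.+ s₀ ℤ.+ s₀)
                        ≡ r ℤ.+ (+ 1 ℤ.+ s₀) ℤ.- + 1 ℤ.+ (r ℤ.+ r′ ℤ.+ (+ 1 ℤ.+ s₀ ℤ.+ s′) ℤ.- + 1) ℤ.- + 1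
    gap = ℤ-Solver.solve-∀

  markovDegree-right : ∀ r s r′ s′ → 1 ≤ s′ →
    markovDegree r s ℤ.≤ markovDegree (r + r′) (s + s′) ℤ.+ markovDegree r′ s′ ℤ.- + 1
  markovDegree-right r s r′ (suc s₀′) _ = ≤-by-gap (r′ + r′ + s₀′ + s₀′) (gap (+ r) (+ s) (+ r′) (+ s₀′))
    where
    gap : ∀ r s r′ s₀′ → r ℤ.+ s ℤ.- + 1 ℤ.+ (r′ ℤ.+ r′ ℤ.+ s₀′ ℤ.+ s₀′)
                        ≡ r ℤ.+ r′ ℤ.+ (s ℤ.+ (+ 1 ℤ.+ s₀′)) ℤ.- + 1 ℤ.+ (r′ ℤ.+ (+ 1 ℤ.+ s₀′) ℤ.- + 1) ℤ.- + 1
    gap = ℤ-Solver.solve-∀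

  MarkovLeadingFor : Laurent → ℤ → ℤ → Set
  MarkovLeadingFor m n d = Σ[ r ∈ ℕ ] Σ[ s ∈ ℕ ] 1 ≤ s × n ℤ.* + s ≡ + r ℤ.* d × MarkovLeading m r s

  pos-cross : ∀ n d r s → n * s ≡ d * r → + n ℤ.* + s ≡ + r ℤ.* + d
  pos-cross n d r s n*s≡d*r =
    trans (sym (ℤ.pos-* n s)) (trans (cong +_ (trans n*s≡d*r (ℕ.*-comm d r))) (ℤ.pos-* r d))

  ≡ᵇ-reflects-≡ : ∀ m n → Reflects (m ≡ n) (m ℕ.≡ᵇ n)
  ≡ᵇ-reflects-≡ m n = fromEquivalence (ℕ.≡ᵇ⇒≡ m n) (ℕ.≡⇒≡ᵇ m n)

  fuel-step : ∀ f {d t u} → d < suc f + u → 1 ≤ t → d < f + (t + u)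
  fuel-step f {d} {t} {u} d<1+f+u t≥1 =
    ℕ.<-≤-trans d<1+f+u (ℕ.≤-trans (ℕ.≤-reflexive (sym (ℕ.+-suc f u)))
                                   (ℕ.+-monoʳ-≤ f (ℕ.+-monoˡ-≤ u t≥1)))

  -- mc stands for m^{(r′-r)/(s′-s)}, of degree (r′ - r) + (s′ - s) - 1, within the bound below.
  descend-markovLeading : ∀ f {n d r s r′ s′ ma mb mc} → Neighbours r s r′ s′ →
    d * r < n * s → n * s′ < d * r′ → d < f + (s + s′) →
    MarkovLeading ma r s → MarkovLeading mb r′ s′ →
    VanishesAbove mc (markovDegree r s ℤ.+ markovDegree r′ s′ ℤ.- + 1) →
    MarkovLeadingFor (descend f n d r s r′ s′ ma mb mc) (+ n) (+ d)
  descend-markovLeading zero {n} nb below above fuel _ _ _ =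
    ⊥-elim (ℕ.<-irrefl refl (ℕ.<-≤-trans fuel (between-neighbours⇒≤ {n} nb below above)))
  descend-markovLeading (suc f) {n} {d} {r} {s} {r′} {s′} nb below above fuel ml ml′ mc≡0
    with n * (s + s′) ℕ.≡ᵇ d * (r + r′) | ≡ᵇ-reflects-≡ (n * (s + s′)) (d * (r + r′))
  ... | true  | ofʸ hit =
    r + r′ , s + s′ , s≥1 (neighbours-right nb) , pos-cross n d (r + r′) (s + s′) hit ,
    mediant-markovLeading r s r′ s′ ml ml′ mc≡0
  ... | false | ofⁿ miss
    with n * (s + s′) ℕ.<ᵇ d * (r + r′) | ℕ.<ᵇ-reflects-< (n * (s + s′)) (d * (r + r′))
  ...   | true  | ofʸ mediant-above =
    descend-markovLeading f (neighbours-left nb) below mediant-above (fuel-step f fuel (s≥1 nb))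
      ml (mediant-markovLeading r s r′ s′ ml ml′ mc≡0)
      (VanishesAbove-mono (markovDegree-left r s r′ s′ (s≥1 nb)) (Monic.vanishesAbove ml′))
  ...   | false | ofⁿ mediant-not-above =
    descend-markovLeading f (neighbours-right nb) mediant-below above
      (subst (d <_) (cong (_+_ f) (ℕ.+-comm s′ (s + s′))) (fuel-step f fuel (s′≥1 nb)))
      (mediant-markovLeading r s r′ s′ ml ml′ mc≡0) ml′
      (VanishesAbove-mono (markovDegree-right r s r′ s′ (s′≥1 nb)) (Monic.vanishesAbove ml))
    where
    mediant-below : d * (r + r′) < n * (s + s′)
    mediant-below = ℕ.≤∧≢⇒< (ℕ.≮⇒≥ mediant-not-above) (miss ∘ sym)

  oneL-markovLeading : MarkovLeading oneL 0 1
  oneL-markovLeading = laurent-monic _ _ refl refl refl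

  qPlusQinv-markovLeading : MarkovLeading qPlusQinv 1 1
  qPlusQinv-markovLeading = laurent-monic _ _ refl refl refl

  qMarkov-markovLeading : ∀ t → 0ℚ ℚ.≤ t → t ℚ.≤ 1ℚ → MarkovLeadingFor (qMarkov t) (↥ t) (↧ t)
  qMarkov-markovLeading (mkℚ -[1+ _ ] _ _) (*≤* ()) _
  qMarkov-markovLeading (mkℚ (+ zero) _ _) _ _ = 0 , 1 , ℕ.≤-refl , refl , oneL-markovLeading
  qMarkov-markovLeading (mkℚ (+ suc n₀) d₁ _) _ (*≤* t≤1)
    with suc n₀ ℕ.≡ᵇ suc d₁ | ≡ᵇ-reflects-≡ (suc n₀) (suc d₁)
  ... | true  | ofʸ n≡d =
    1 , 1 , ℕ.≤-refl , pos-cross (suc n₀) (suc d₁) 1 1 (cong (ℕ._* 1) n≡d) , qPlusQinv-markovLeading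
  ... | false | ofⁿ n≢d =
    descend-markovLeading (suc d₁) {ma = oneL} {qPlusQinv} {oneL} 0/1-1/1 below above
      (ℕ.m<m+n (suc d₁) (ℕ.s≤s ℕ.z≤n))
      oneL-markovLeading qPlusQinv-markovLeading (Monic.vanishesAbove oneL-markovLeading)
    where
    0/1-1/1 : Neighbours 0 1 1 1
    0/1-1/1 = record { unimodular = refl ; s≥1 = ℕ.≤-refl ; s′≥1 = ℕ.≤-refl }
    n≤d : suc n₀ ℕ.≤ suc d₁
    n≤d = ℤ.drop‿+≤+ (subst₂ ℤ._≤_ (ℤ.*-identityʳ _) (ℤ.*-identityˡ _) t≤1)
    below : suc d₁ ℕ.* 0 ℕ.< suc n₀ ℕ.* 1
    below = subst₂ ℕ._<_ (sym (ℕ.*-zeroʳ (suc d₁))) (sym (ℕ.*-identityʳ (suc n₀))) (ℕ.s≤s ℕ.z≤n)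
    above : suc n₀ ℕ.* 1 ℕ.< suc d₁ ℕ.* 1
    above = subst₂ ℕ._<_ (sym (ℕ.*-identityʳ (suc n₀))) (sym (ℕ.*-identityʳ (suc d₁))) (ℕ.≤∧≢⇒< n≤d n≢d)

open FareyDescent

module Quotients where

  open import Data.Rational using (mkℚ; 1ℚ; _*_; _/_; _÷_; 1/_; NonZero; toℚᵘ; ↥_; ↧_)
  import Data.Rational.Properties as ℚ
  open import Data.Rational.Unnormalised as ℚᵘ using (mkℚᵘ; *≡*)
  import Data.Rational.Unnormalised.Properties as ℚᵘ

  /1-nonZero : ∀ s → 1 ℕ.≤ s → NonZero (+ s / 1)
  /1-nonZero (suc s₀) _ = ℚ.pos⇒nonZero (+ suc s₀ / 1) {{ℚ.normalize-pos (suc s₀) 1}}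

  *[/1]≡/1 : ∀ t r s → ↥ t ℤ.* s ≡ r ℤ.* ↧ t → t * (s / 1) ≡ r / 1
  *[/1]≡/1 t@(mkℚ n d₁ _) r s cross = ℚ.toℚᵘ-injective (begin
    toℚᵘ (t * (s / 1))            ≈⟨ ℚ.toℚᵘ-homo-* t (s / 1) ⟩
    toℚᵘ t ℚᵘ.* toℚᵘ (s / 1)      ≈⟨ ℚᵘ.*-congˡ {toℚᵘ t} (ℚ.toℚᵘ-fromℚᵘ (mkℚᵘ s 0)) ⟩
    toℚᵘ t ℚᵘ.* mkℚᵘ s 0          ≈⟨ *≡* cross′ ⟩
    mkℚᵘ r 0                      ≈⟨ ℚ.toℚᵘ-fromℚᵘ (mkℚᵘ r 0) ⟨
    toℚᵘ (r / 1)                  ∎)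
    where
    open ℚᵘ.≃-Reasoning
    cross′ : n ℤ.* s ℤ.* + 1 ≡ r ℤ.* + (suc d₁ ℕ.* 1)
    cross′ = trans (ℤ.*-identityʳ (n ℤ.* s))
                   (trans cross (cong (λ e → r ℤ.* + e) (sym (ℕ.*-identityʳ (suc d₁)))))

  *≡⇒≡÷ : ∀ t x y .{{_ : NonZero y}} → t * y ≡ x → t ≡ x ÷ y
  *≡⇒≡÷ t x y t*y≡x = begin
    t                  ≡⟨ ℚ.*-identityʳ t ⟨
    t * 1ℚ             ≡⟨ cong (t *_) (ℚ.*-inverseʳ y) ⟨
    t * (y * 1/ y)     ≡⟨ ℚ.*-assoc t y (1/ y) ⟨
    t * y * 1/ y       ≡⟨ cong (_* 1/ y) t*y≡x ⟩
    x * 1/ y           ∎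
    where open ≡-Reasoning

open Quotients

open import Data.Nat using (_≥_)
open import Data.Integer using (-_; _<_; _>_)
open import Data.Rational using (ℚ; 0ℚ; 1ℚ; _≤_; _/_; _÷_; NonZero)
open import Data.Product using (Σ; _,_)
open import Data.Integer.Tactic.RingSolver using (solve-∀)

lemma5p5 : (t : ℚ) → 0ℚ ≤ t → t ≤ 1ℚ →
    (d : ℕ) → d ≥ 1 → (α : ℤ) →
    coeff (qMarkov t) (+ d) ≡ + 1 →
    coeff (qMarkov t) (- (+ d)) ≡ + 1 →
    (∀ (k : ℤ) → k > + d → coeff (qMarkov t) k ≡ + 0) →
    (∀ (k : ℤ) → k < - (+ d) → coeff (qMarkov t) k ≡ + 0) →
    coeff (qMarkov t) (+ d ℤ.- + 1) ≡ α →
    coeff (qMarkov t) (+ 1 ℤ.- + d) ≡ α →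
    Σ (NonZero ((α ℤ.+ + 1) / 1))
      (λ nz → t ≡ _÷_ ((+ d ℤ.- α) / 1) ((α ℤ.+ + 1) / 1) {{nz}})
lemma5p5 t 0≤t t≤1 d _ α leading-d _ vanishesAbove-d _ subleading-d _
  with qMarkov-markovLeading t 0≤t t≤1
... | r , s , s≥1 , cross , ml = as-quotient (sym numerator) (sym denominator)
  where
  d≡deg : + d ≡ markovDegree r s
  d≡deg = monic-degree-unique ml leading-d vanishesAbove-d
  α≡s-1 : α ≡ + s ℤ.- + 1
  α≡s-1 = trans (sym subleading-d) (trans (cong (λ D → coeff (qMarkov t) (D ℤ.- + 1)) d≡deg) (Monic.subleading ml))
  numerator : + d ℤ.- α ≡ + r
  numerator = trans (cong₂ ℤ._-_ d≡deg α≡s-1) (cancel (+ r) (+ s))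
    where
    cancel : ∀ r s → r ℤ.+ s ℤ.- + 1 ℤ.- (s ℤ.- + 1) ≡ r
    cancel = solve-∀
  denominator : α ℤ.+ + 1 ≡ + s
  denominator = trans (cong (ℤ._+ + 1) α≡s-1) (cancel (+ s))
    where
    cancel : ∀ s → s ℤ.- + 1 ℤ.+ + 1 ≡ s
    cancel = solve-∀
  as-quotient : ∀ {a b} → + r ≡ a → + s ≡ b → Σ (NonZero (b / 1)) (λ nz → t ≡ _÷_ (a / 1) (b / 1) {{nz}})
  as-quotient refl refl =
    /1-nonZero s s≥1 , *≡⇒≡÷ t (+ r / 1) (+ s / 1) {{/1-nonZero s s≥1}} (*[/1]≡/1 t (+ r) (+ s) cross)
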